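{- Let $\Gamma=(V_0,V_1,E,w)$ be a game graph, $k\in\mathbb{N}$, $K=\{0,\dots,k\}$, and define $\mathcal{E}:K^V\to K^V$ by $\mathcal{E}(a)(v)=\min_{(v,v')\in E}a(v')\ominus_{\mathbb{Z}}w(v,v')$ for $v\in V_0$ and $\mathcal{E}(a)(v)=\max_{(v,v')\in E}a(v')\ominus_{\mathbb{Z}}w(v,v')$ for $v\in V_1$, where $x\ominus_{\mathbb{Z}}y=\min\{\max\{x-y,0\},k\}$. Then $\mathcal{E}$ is non-expansive, i.e.\ $\|\mathcal{E}(b)\ominus\mathcal{E}(a)\|\le\|b\ominus a\|$ for all $a,b\in K^V$.
   Context: A game graph is $\Gamma=(V_0,V_1,E,w)$ with $V=V_0\cup V_1$ a finite set, $V_0\cap V_1=\emptyset$, $E\subseteq V\times V$ such that every state has at least one outgoing edge, and $w:E\to\mathbb{Z}$. $K=\{0,\dots,k\}$ is the MV-chain with $n\oplus m=\min\{n+m,k\}$, complement $\overline{n}=k-n$, natural order the usual order, and $n\ominus m=\max\{n-m,0\}$; on $K^V$, $\ominus$ is taken pointwise and $\|a\|=\max_{v\in V}a(v)$. -}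

module Defs where

open import Data.Nat using (ℕ; zero; suc; _⊔_; _⊓_; _∸_)
open import Data.Integer as ℤ using (ℤ; +_)
open import Data.Fin using (Fin; toℕ)
open import Data.List using (List; filter; map; foldr)
open import Data.List.Base using ()
open import Data.Bool using (Bool; true; false; T; if_then_else_)
open import Data.Vec.Functional using ()
open import Data.Fin.Base using ()
open import Data.List using () renaming (allFin to allFinL)
open import Data.Product using (Σ; _×_)
open import Relation.Nullary.Decidable using (does)
open import Data.Bool.Properties using (T?)

-- A game graph on the finite state set V = Fin n.
-- owner v = false means v ∈ V₀ (min player), owner v = true means v ∈ V₁.
-- edge v v' = true iff (v , v') ∈ E.  Weights w are only used on edges.
record GameGraph (n : ℕ) : Set where
  field
    owner : Fin n → Bool
    edge  : Fin n → Fin n → Bool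
    total : (v : Fin n) → Σ (Fin n) (λ v' → T (edge v v'))
    w     : Fin n → Fin n → ℤ

-- The MV-chain K = {0,…,k} is represented by ℕ; elements of K^V are
-- functions a : Fin n → ℕ with a v ≤ k for all v.
InK : ℕ → ∀ {n} → (Fin n → ℕ) → Set
InK k a = ∀ v → a v Data.Nat.≤ k

_⊖_ : ℕ → ℕ → ℕ
_⊖_ = _∸_

⊖ℤ : (k : ℕ) → ℕ → ℤ → ℕ
⊖ℤ k x y = ℤ.∣ (+ x ℤ.- y) ℤ.⊔ + 0 ∣ ⊓ k

succs : ∀ {n} → GameGraph n → Fin n → List (Fin n)
succs {n} G v = filter (λ v' → T? (GameGraph.edge G v v')) (allFinL n)

-- min / max over a list of elements of K (the successor lists are
-- nonempty by totality, so the neutral elements k and 0 never matter).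
minK : ℕ → List ℕ → ℕ
minK k = foldr _⊓_ k

maxK : List ℕ → ℕ
maxK = foldr _⊔_ 0

𝓔 : ∀ {n} → GameGraph n → (k : ℕ) → (Fin n → ℕ) → Fin n → ℕ
𝓔 G k a v with GameGraph.owner G v
... | false = minK k (map (λ v' → ⊖ℤ k (a v') (GameGraph.w G v v')) (succs G v))
... | true  = maxK   (map (λ v' → ⊖ℤ k (a v') (GameGraph.w G v v')) (succs G v))

_⊖ᵥ_ : ∀ {n} → (Fin n → ℕ) → (Fin n → ℕ) → Fin n → ℕ
(b ⊖ᵥ a) v = b v ⊖ a v

∥_∥ : ∀ {n} → (Fin n → ℕ) → ℕ
∥_∥ {n} a = maxK (map a (allFinL n))

{-# OPTIONS --safe #-}
-- Each ingredient of 𝓔 — subtracting a fixed weight, truncating to [0, k], and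
-- taking min or max over the successors — maps values satisfying b ≤ a + D to
-- values satisfying the same inequality.  Since ∥ b ⊖ᵥ a ∥ ≤ D says exactly that
-- b v ≤ a v + D for every v, the bound D = ∥ b ⊖ᵥ a ∥ passes through 𝓔.
module Submission where

open import Defs
open import Data.Nat using (ℕ; _≤_; _+_; _⊔_; _⊓_; z≤n; suc)
open import Data.Nat.Properties
open import Data.Fin using (Fin)
open import Data.Bool using (true; false)
open import Data.List using (List; []; _∷_; map) renaming (allFin to allFinL)
open import Data.List.Membership.Propositional using (_∈_)
open import Data.List.Membership.Propositional.Properties using (∈-allFin)
open import Data.List.Relation.Unary.Any using (here; there)
open import Data.Integer as ℤ using (ℤ; +_; -[1+_])
import Data.Integer.Properties as ℤ
open import Algebra.Properties.CommutativeSemigroup ℤ.+-commutativeSemigroup using (xy∙z≈xz∙y)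
open import Function using (_⇔_; mk⇔; Equivalence)
open import Relation.Binary.PropositionalEquality using (refl; cong)

∣⊔0∣ : ℤ → ℕ
∣⊔0∣ t = ℤ.∣ t ℤ.⊔ + 0 ∣

∣⊔0∣-≤-+ : ∀ s t D → s ℤ.≤ t ℤ.+ + D → ∣⊔0∣ s ≤ ∣⊔0∣ t + D
∣⊔0∣-≤-+ -[1+ _ ] t        D _ = z≤n
∣⊔0∣-≤-+ (+ p)    (+ q)    D (ℤ.+≤+ p≤q+D)
  rewrite ⊔-identityʳ p | ⊔-identityʳ q = p≤q+D
∣⊔0∣-≤-+ (+ p)    -[1+ q ] D p≤-q+D rewrite ⊔-identityʳ p =
  ℤ.drop‿+≤+ (ℤ.≤-trans p≤-q+D (ℤ.m⊖n≤m D (suc q)))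

⊓-≤-+ : ∀ {a b} c D → a ≤ b + D → a ⊓ c ≤ b ⊓ c + D
⊓-≤-+ {a} {b} c D a≤b+D = begin
  a ⊓ c             ≤⟨ ⊓-mono-≤ a≤b+D (m≤m+n c D) ⟩
  (b + D) ⊓ (c + D) ≡⟨ +-distribʳ-⊓ D b c ⟨
  b ⊓ c + D         ∎
  where open ≤-Reasoning

⊖ℤ-≤-+ : ∀ k {x z} D y → x ≤ z + D → ⊖ℤ k x y ≤ ⊖ℤ k z y + D
⊖ℤ-≤-+ k {x} {z} D y x≤z+D = ⊓-≤-+ k D (∣⊔0∣-≤-+ _ (+ z ℤ.- y) D x-y≤z-y+D)
  where
  x-y≤z-y+D : + x ℤ.- y ℤ.≤ (+ z ℤ.- y) ℤ.+ + D
  x-y≤z-y+D = begin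
    + x ℤ.- y           ≤⟨ ℤ.+-monoˡ-≤ (ℤ.- y) (ℤ.+≤+ x≤z+D) ⟩
    + (z + D) ℤ.- y     ≡⟨ cong (ℤ._- y) (ℤ.pos-+ z D) ⟩
    + z ℤ.+ + D ℤ.- y   ≡⟨ xy∙z≈xz∙y (+ z) (+ D) (ℤ.- y) ⟩
    (+ z ℤ.- y) ℤ.+ + D ∎
    where open ℤ.≤-Reasoning

minK-≤-+ : ∀ {A : Set} k D (f g : A → ℕ) (xs : List A) → (∀ x → f x ≤ g x + D) →
  minK k (map f xs) ≤ minK k (map g xs) + D
minK-≤-+ k D f g []       f≤g+D = m≤m+n k D
minK-≤-+ k D f g (x ∷ xs) f≤g+D = begin
  f x ⊓ minK k (map f xs)             ≤⟨ ⊓-mono-≤ (f≤g+D x) (minK-≤-+ k D f g xs f≤g+D) ⟩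
  (g x + D) ⊓ (minK k (map g xs) + D) ≡⟨ +-distribʳ-⊓ D (g x) _ ⟨
  g x ⊓ minK k (map g xs) + D         ∎
  where open ≤-Reasoning

maxK-≤-+ : ∀ {A : Set} D (f g : A → ℕ) (xs : List A) → (∀ x → f x ≤ g x + D) →
  maxK (map f xs) ≤ maxK (map g xs) + D
maxK-≤-+ D f g []       f≤g+D = z≤n
maxK-≤-+ D f g (x ∷ xs) f≤g+D = begin
  f x ⊔ maxK (map f xs)             ≤⟨ ⊔-mono-≤ (f≤g+D x) (maxK-≤-+ D f g xs f≤g+D) ⟩
  (g x + D) ⊔ (maxK (map g xs) + D) ≡⟨ +-distribʳ-⊔ D (g x) _ ⟨
  g x ⊔ maxK (map g xs) + D         ∎
  where open ≤-Reasoning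

≤-maxK : ∀ {A : Set} (f : A → ℕ) {xs : List A} {x} → x ∈ xs → f x ≤ maxK (map f xs)
≤-maxK f {y ∷ xs} (here refl) = m≤m⊔n (f y) _
≤-maxK f {y ∷ xs} (there x∈xs) = ≤-trans (≤-maxK f x∈xs) (m≤n⊔m (f y) _)

maxK-≤ : ∀ {A : Set} (f : A → ℕ) (xs : List A) {D} → (∀ x → f x ≤ D) → maxK (map f xs) ≤ D
maxK-≤ f []       f≤D = z≤n
maxK-≤ f (y ∷ xs) f≤D = ⊔-lub (f≤D y) (maxK-≤ f xs f≤D)

∥⊖ᵥ∥≤⇔≤+ : ∀ {n} (a b : Fin n → ℕ) D → ∥ b ⊖ᵥ a ∥ ≤ D ⇔ (∀ v → b v ≤ a v + D)
∥⊖ᵥ∥≤⇔≤+ {n} a b D = mk⇔ pointwise norm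
  where
  pointwise : ∥ b ⊖ᵥ a ∥ ≤ D → ∀ v → b v ≤ a v + D
  pointwise ∥b⊖a∥≤D v = ≤-trans (m≤n+m∸n (b v) (a v))
    (+-monoʳ-≤ (a v) (≤-trans (≤-maxK (b ⊖ᵥ a) (∈-allFin v)) ∥b⊖a∥≤D))
  norm : (∀ v → b v ≤ a v + D) → ∥ b ⊖ᵥ a ∥ ≤ D
  norm b≤a+D = maxK-≤ (b ⊖ᵥ a) (allFinL n) λ v → m≤n+o⇒m∸n≤o (b v) (a v) (b≤a+D v)

𝓔-≤-+ : ∀ {n} (G : GameGraph n) k {a b : Fin n → ℕ} D →
  (∀ v → b v ≤ a v + D) → ∀ v → 𝓔 G k b v ≤ 𝓔 G k a v + D
𝓔-≤-+ G k D b≤a+D v with GameGraph.owner G v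
... | false = minK-≤-+ k D _ _ (succs G v) λ v' → ⊖ℤ-≤-+ k D (GameGraph.w G v v') (b≤a+D v')
... | true  = maxK-≤-+ D _ _ (succs G v) λ v' → ⊖ℤ-≤-+ k D (GameGraph.w G v v') (b≤a+D v')

mainTheorem12 : ∀ {n} (G : GameGraph n) (k : ℕ) (a b : Fin n → ℕ) →
    InK k a → InK k b →
    ∥ 𝓔 G k b ⊖ᵥ 𝓔 G k a ∥ ≤ ∥ b ⊖ᵥ a ∥
mainTheorem12 G k a b _ _ = Equivalence.from (∥⊖ᵥ∥≤⇔≤+ (𝓔 G k a) (𝓔 G k b) D)
  (𝓔-≤-+ G k D (Equivalence.to (∥⊖ᵥ∥≤⇔≤+ a b D) ≤-refl))
  where D = ∥ b ⊖ᵥ a ∥
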